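{- Suppose $\mathcal H$ is a $3$-uniform hypergraph on $m$ vertices with at least $dm^3$ edges. Then there is a tight path in $\mathcal H$ which covers at least $2(dm+1)$ vertices. In particular, if $\mathcal H$ is $3$-partite with partition classes $V_1,V_2,V_3$ and $2dm>10$, then for each $i\in[3]$ there is a copy of $\mathcal M$ in $\mathcal H$ which intersects $V_i$ in exactly two vertices and each of the other two partition classes in exactly three vertices.
   Context: A $3$-uniform hypergraph is a tight path if there is an ordering $(v_1,\dots,v_t)$ of its vertices such that every edge consists of three consecutive vertices, every vertex is contained in an edge, and two consecutive edges intersect in exactly two vertices. $\mathcal H$ being $3$-partite with classes $V_1,V_2,V_3$ means its vertex set is the disjoint union of $V_1,V_2,V_3$ and every edge has exactly one vertex in each class. $\mathcal M$ is the $3$-uniform hypergraph with vertex set $\{1,\dots,8\}$ and edges $\{1,2,3\},\{3,4,5\},\{4,5,6\},\{6,7,8\}$; a copy of $\mathcal M$ is a subhypergraph isomorphic to $\mathcal M$. -}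

module Defs where

open import Data.Nat as ℕ using (ℕ; zero; suc; _^_)
open import Data.Integer using (+_)
open import Data.Rational using (ℚ; _/_)
open import Data.Fin using (Fin; toℕ)
open import Data.Product using (_×_; Σ; ∃; ∃-syntax; _,_)
open import Data.Sum using (_⊎_)
open import Data.Unit using (⊤)
open import Data.List using (List; []; _∷_; length; filter; allFin)
open import Data.List.Relation.Unary.Any using (Any)
open import Data.List.Relation.Unary.All using (All)
open import Data.List.Relation.Unary.Unique.Propositional using (Unique)
open import Relation.Binary.PropositionalEquality using (_≡_; _≢_)
open import Relation.Nullary using (¬_)
open import Function.Definitions using (Injective)
open import Data.Fin using (#_)

ℕtoℚ : ℕ → ℚ
ℕtoℚ n = (+ n) / 1

Sorted3 : {m : ℕ} → Fin m × Fin m × Fin m → Set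
Sorted3 (a , b , c) = (toℕ a ℕ.< toℕ b) × (toℕ b ℕ.< toℕ c)

-- a 3-uniform hypergraph on the vertex set Fin m: a finite set of
-- 3-element subsets, each listed once in sorted form
record Hypergraph3 (m : ℕ) : Set where
  field
    edges       : List (Fin m × Fin m × Fin m)
    edgesSorted : All Sorted3 edges
    edgesUnique : Unique edges
open Hypergraph3 public

∣E∣ : {m : ℕ} → Hypergraph3 m → ℕ
∣E∣ H = length (edges H)

_∈₃_ : {m : ℕ} → Fin m → Fin m × Fin m × Fin m → Set
x ∈₃ (a , b , c) = (x ≡ a) ⊎ (x ≡ b) ⊎ (x ≡ c)

IsEdge : {m : ℕ} → Hypergraph3 m → Fin m → Fin m → Fin m → Set
IsEdge H x y z =
  (x ≢ y) × (y ≢ z) × (x ≢ z) ×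
  Any (λ e → (x ∈₃ e) × (y ∈₃ e) × (z ∈₃ e)) (edges H)

ConsecutiveEdges : {m : ℕ} → Hypergraph3 m → List (Fin m) → Set
ConsecutiveEdges H (x ∷ y ∷ z ∷ rest) = IsEdge H x y z × ConsecutiveEdges H (y ∷ z ∷ rest)
ConsecutiveEdges H _ = ⊤

-- a tight path in H, given by its vertex ordering (v₁,…,v_t): distinct
-- vertices, t ≥ 3 (every vertex lies in an edge), and its edges are
-- exactly the consecutive triples {vᵢ,vᵢ₊₁,vᵢ₊₂}, all of which are edges of H
record TightPath {m : ℕ} (H : Hypergraph3 m) : Set where
  field
    vertices  : List (Fin m)
    distinct  : Unique vertices
    atLeast3  : 3 ℕ.≤ length vertices
    tight     : ConsecutiveEdges H vertices
open TightPath public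

-- H is 3-partite with classes V₁,V₂,V₃ given by part⁻¹(i)
ThreePartite : {m : ℕ} → Hypergraph3 m → (Fin m → Fin 3) → Set
ThreePartite H part =
  All (λ { (a , b , c) → (part a ≢ part b) × (part b ≢ part c) × (part a ≢ part c) }) (edges H)

-- the hypergraph M on {1,…,8} (here Fin 8 = {0,…,7}) with edges
-- {1,2,3},{3,4,5},{4,5,6},{6,7,8}
M-edges : List (Fin 8 × Fin 8 × Fin 8)
M-edges = (# 0 , # 1 , # 2) ∷ (# 2 , # 3 , # 4) ∷ (# 3 , # 4 , # 5) ∷ (# 5 , # 6 , # 7) ∷ []

record CopyOfM {m : ℕ} (H : Hypergraph3 m) : Set where
  field
    emb       : Fin 8 → Fin m
    injective : Injective _≡_ _≡_ emb
    edgesMap  : All (λ { (a , b , c) → IsEdge H (emb a) (emb b) (emb c) }) M-edges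
open CopyOfM public

meetCount : {m : ℕ} {H : Hypergraph3 m} → (Fin m → Fin 3) → CopyOfM H → Fin 3 → ℕ
meetCount part C i = length (filter (λ j → part (emb C j) Data.Fin.≟ i) (allFin 8))

-- Let K = ⌊2dm⌋ (precisely ⌊2pm/q⌋ for d = p/q). Repeatedly delete all edges through a pair of
-- vertices lying in between 1 and K edges: each round destroys at most K edges and one of the
-- (m choose 2) pairs, and |E| ≥ dm³ > K (m choose 2), so some edges survive, and afterwards every
-- pair lying in an edge lies in more than K of them. A tight path can then be grown greedily:
-- the edges through its two newest vertices have distinct third vertices, more than the path
-- has, so one of them is new. This yields K + 3 ≥ 2(dm + 1) vertices. In a 3-partite
-- hypergraph the classes along a tight path repeat with period 3, so eight consecutive
-- vertices whose third one lies in Vᵢ span a copy of M meeting Vᵢ twice and the other classes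
-- three times each; 2dm > 10 makes the path long enough to choose such a window.

module Submission where

open import Defs
open import Data.Nat using (ℕ; NonZero; _^_)
open import Data.Rational using (ℚ; _≤_; _<_; _*_; _+_; 0ℚ; 1ℚ)
open import Data.Fin using (Fin)
open import Data.Product using (_×_; ∃-syntax)
open import Data.List using (length)
open import Relation.Binary.PropositionalEquality using (_≡_; _≢_)

open import Data.Nat as ℕ using (zero; suc; z≤n; s≤s)
import Data.Nat.Properties as ℕ
open import Data.Nat.DivMod using (_/_; _%_; m≡m%n+[m/n]*n; m%n<n; m/n*n≤m)
open import Data.Nat.Coprimality using (Coprime; 1-coprimeTo) renaming (sym to coprime-sym)
open import Data.Nat.Induction using (<-wellFounded)
open import Data.Nat.Tactic.RingSolver using (solve-∀)
open import Data.Integer as ℤ using (+_; -[1+_])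
import Data.Integer.Properties as ℤ
open import Data.Rational using (mkℚ; toℚᵘ; *<*)
open import Data.Rational.Properties
  using (normalize-coprime; toℚᵘ-homo-*; toℚᵘ-homo-+; toℚᵘ-mono-≤; toℚᵘ-mono-<; toℚᵘ-cancel-≤)
open import Data.Rational.Unnormalised as ℚᵘ using (ℚᵘ; mkℚᵘ; _≃_)
import Data.Rational.Unnormalised.Properties as ℚᵘ
open import Data.Fin using (zero; suc; toℕ; _≟_)
open import Data.Fin.Properties using (toℕ-injective; injective⇒≤; all?)
open import Data.Product using (_,_; proj₁; proj₂; swap; Σ)
open import Data.Sum using (_⊎_; inj₁; inj₂)
open import Data.Unit using (tt)
open import Data.List using (List; []; _∷_; lookup; filter; map; _++_; allFin)
open import Data.List.Properties
  using (length-tabulate; length-++; length-map; length-filter; filter-≐; filter-none; filter-some)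
open import Data.List.Relation.Unary.Any using (Any; here; there; index; any?)
open import Data.List.Relation.Unary.Any.Properties using (lookup-index)
open import Data.List.Relation.Unary.All as All using (All; []; _∷_)
open import Data.List.Relation.Unary.All.Properties as All using (¬All⇒Any¬; ¬Any⇒All¬; map⁺; all-filter)
open import Data.List.Relation.Unary.AllPairs as AllPairs using ([]; _∷_)
open import Data.List.Relation.Unary.Unique.Propositional using (Unique)
import Data.List.Relation.Unary.Unique.Propositional.Properties as Unique
open import Data.List.Membership.Propositional using (_∈_; _∉_; find; lose)
open import Data.List.Membership.Propositional.Properties
  using (∈-lookup; ∈-allFin; ∈-map⁺; ∈-map⁻; ∈-filter⁻; ∈-++⁺ˡ; ∈-++⁺ʳ)
import Data.List.Membership.DecPropositional as DecMembership
open import Data.List.Relation.Binary.Sublist.Propositional using (⊆-refl)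
open import Data.List.Relation.Binary.Sublist.Propositional.Properties as Sublist using (length-mono-≤)
open import Function using (_∘_; id)
open import Function.Definitions using (Injective)
open import Induction.WellFounded using (Acc; acc)
open import Relation.Binary.Definitions using (DecidableEquality)
open import Relation.Binary.PropositionalEquality
  using (refl; sym; trans; cong; cong₂; subst; subst₂; module ≡-Reasoning)
open import Relation.Nullary using (Dec; yes; no; ¬_; contradiction)
open import Relation.Nullary.Decidable using (_⊎-dec_; _×-dec_; _→-dec_; ¬?; from-yes)
open import Relation.Unary using (Decidable)
open import Relation.Unary.Properties using (∁?)

Distinct₃ : {A : Set} → A → A → A → Set
Distinct₃ x y z = x ≢ y × y ≢ z × x ≢ z

module _ {A : Set} where

  lookup-injective : {xs : List A} → Unique xs → Injective _≡_ _≡_ (lookup xs)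
  lookup-injective (x∉xs ∷ _) {zero}  {zero}  _   = refl
  lookup-injective (x∉xs ∷ _) {zero}  {suc j} x≡  = contradiction x≡ (All.lookup x∉xs (∈-lookup j))
  lookup-injective (x∉xs ∷ _) {suc i} {zero}  ≡x  = contradiction (sym ≡x) (All.lookup x∉xs (∈-lookup i))
  lookup-injective (_ ∷ xs!)  {suc i} {suc j} eq  = cong suc (lookup-injective xs! eq)

  Unique⇒length≤ : {xs ys : List A} → Unique xs → All (_∈ ys) xs → length xs ℕ.≤ length ys
  Unique⇒length≤ {xs} {ys} xs! xs⊆ys = injective⇒≤ position-injective
    where
    position : Fin (length xs) → Fin (length ys)
    position i = index (All.lookup xs⊆ys (∈-lookup i))

    position-injective : Injective _≡_ _≡_ position
    position-injective {i} {j} eq = lookup-injective xs! (begin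
      lookup xs i             ≡⟨ lookup-index (All.lookup xs⊆ys (∈-lookup i)) ⟩
      lookup ys (position i)  ≡⟨ cong (lookup ys) eq ⟩
      lookup ys (position j)  ≡⟨ lookup-index (All.lookup xs⊆ys (∈-lookup j)) ⟨
      lookup xs j             ∎)
      where open ≡-Reasoning

  module _ (_≟ᴬ_ : DecidableEquality A) where
    open DecMembership _≟ᴬ_ using (_∈?_)

    Unique⇒∃∉ : {xs ys : List A} → Unique xs → length ys ℕ.< length xs → ∃[ x ] x ∈ xs × x ∉ ys
    Unique⇒∃∉ {xs} {ys} xs! ys<xs with All.all? (_∈? ys) xs
    ... | yes xs⊆ys = contradiction (Unique⇒length≤ xs! xs⊆ys) (ℕ.<⇒≱ ys<xs)
    ... | no xs⊈ys  = find (¬All⇒Any¬ (_∈? ys) xs xs⊈ys)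

  Unique-map⁺ : {B : Set} {P : A → Set} {f : A → B} → (∀ {a a′} → P a → P a′ → f a ≡ f a′ → a ≡ a′) →
                {xs : List A} → All P xs → Unique xs → Unique (map f xs)
  Unique-map⁺ f-inj []         []          = []
  Unique-map⁺ f-inj (pa ∷ pxs) (a∉xs ∷ xs!) =
    map⁺ (All.zipWith (λ (a≢b , pb) fa≡fb → a≢b (f-inj pa pb fa≡fb)) (a∉xs , pxs)) ∷ Unique-map⁺ f-inj pxs xs!

  module _ {P : A → Set} (P? : Decidable P) where

    length-filter+∁ : ∀ xs → length (filter P? xs) ℕ.+ length (filter (∁? P?) xs) ≡ length xs
    length-filter+∁ []       = refl
    length-filter+∁ (x ∷ xs) with P? x
    ... | yes _ = cong suc (length-filter+∁ xs)
    ... | no _  = trans (ℕ.+-suc _ _) (cong suc (length-filter+∁ xs))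

    module _ {Q : A → Set} (Q? : Decidable Q) (P⇒Q : ∀ {x} → P x → Q x) where

      length-filter-mono : ∀ xs → length (filter P? xs) ℕ.≤ length (filter Q? xs)
      length-filter-mono xs = length-mono-≤ (Sublist.filter⁺ P? Q? (λ { refl → P⇒Q }) (⊆-refl {x = xs}))

      length-filter-< : ∀ {xs} → Any (λ x → Q x × ¬ P x) xs → length (filter P? xs) ℕ.< length (filter Q? xs)
      length-filter-< {x ∷ xs} (here (qx , ¬px)) with P? x | Q? x
      ... | yes px | _      = contradiction px ¬px
      ... | no _   | no ¬qx = contradiction qx ¬qx
      ... | no _   | yes _  = s≤s (length-filter-mono xs)
      length-filter-< {x ∷ xs} (there any) with P? x | Q? x
      ... | yes _  | yes _  = s≤s (length-filter-< any)
      ... | yes px | no ¬qx = contradiction (P⇒Q px) ¬qx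
      ... | no _   | yes _  = ℕ.m<n⇒m<1+n (length-filter-< any)
      ... | no _   | no _   = length-filter-< any

  unorderedPairs : List A → List (A × A)
  unorderedPairs []       = []
  unorderedPairs (x ∷ xs) = map (x ,_) xs ++ unorderedPairs xs

  ∈-unorderedPairs : {x y : A} {xs : List A} → x ∈ xs → y ∈ xs → x ≢ y →
                     (x , y) ∈ unorderedPairs xs ⊎ (y , x) ∈ unorderedPairs xs
  ∈-unorderedPairs (here refl) (here refl) x≢y = contradiction refl x≢y
  ∈-unorderedPairs (here refl) (there y∈)  _   = inj₁ (∈-++⁺ˡ (∈-map⁺ _ y∈))
  ∈-unorderedPairs (there x∈)  (here refl) _   = inj₂ (∈-++⁺ˡ (∈-map⁺ _ x∈))
  ∈-unorderedPairs {xs = z ∷ zs} (there x∈) (there y∈) x≢y with ∈-unorderedPairs x∈ y∈ x≢y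
  ... | inj₁ xy∈ = inj₁ (∈-++⁺ʳ (map (z ,_) zs) xy∈)
  ... | inj₂ yx∈ = inj₂ (∈-++⁺ʳ (map (z ,_) zs) yx∈)

  length-unorderedPairs : ∀ xs → 2 ℕ.* length (unorderedPairs xs) ℕ.+ length xs ≡ length xs ℕ.* length xs
  length-unorderedPairs []       = refl
  length-unorderedPairs (x ∷ xs) = begin
    2 ℕ.* length (map (x ,_) xs ++ unorderedPairs xs) ℕ.+ suc n
      ≡⟨ cong (λ k → 2 ℕ.* k ℕ.+ suc n) (trans (length-++ (map (x ,_) xs)) (cong (ℕ._+ p) (length-map (x ,_) xs))) ⟩
    2 ℕ.* (n ℕ.+ p) ℕ.+ suc n        ≡⟨ regroup n p ⟩
    (2 ℕ.* p ℕ.+ n) ℕ.+ suc (2 ℕ.* n) ≡⟨ cong (ℕ._+ suc (2 ℕ.* n)) (length-unorderedPairs xs) ⟩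
    n ℕ.* n ℕ.+ suc (2 ℕ.* n)         ≡⟨ square-suc n ⟩
    suc n ℕ.* suc n                   ∎
    where
    open ≡-Reasoning
    n = length xs
    p = length (unorderedPairs xs)
    regroup : ∀ n p → 2 ℕ.* (n ℕ.+ p) ℕ.+ suc n ≡ (2 ℕ.* p ℕ.+ n) ℕ.+ suc (2 ℕ.* n)
    regroup = solve-∀
    square-suc : ∀ n → n ℕ.* n ℕ.+ suc (2 ℕ.* n) ≡ suc n ℕ.* suc n
    square-suc = solve-∀

bound-after-removal : ∀ {c K p p′ l} → c ℕ.≤ K → p′ ℕ.< p → K ℕ.* p ℕ.< c ℕ.+ l → K ℕ.* p′ ℕ.< l
bound-after-removal {c} {K} {p} {p′} {l} c≤K p′<p Kp<c+l = ℕ.+-cancelʳ-< K (K ℕ.* p′) l (begin-strict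
  K ℕ.* p′ ℕ.+ K  ≡⟨ ℕ.+-comm (K ℕ.* p′) K ⟩
  K ℕ.+ K ℕ.* p′  ≡⟨ ℕ.*-suc K p′ ⟨
  K ℕ.* suc p′    ≤⟨ ℕ.*-monoʳ-≤ K p′<p ⟩
  K ℕ.* p         <⟨ Kp<c+l ⟩
  c ℕ.+ l         ≤⟨ ℕ.+-monoˡ-≤ l c≤K ⟩
  K ℕ.+ l         ≡⟨ ℕ.+-comm K l ⟩
  l ℕ.+ K         ∎)
  where open ℕ.≤-Reasoning

m<[1+m/n]*n : ∀ a q .{{_ : NonZero q}} → a ℕ.< suc (a / q) ℕ.* q
m<[1+m/n]*n a q = begin-strict
  a                      ≡⟨ m≡m%n+[m/n]*n a q ⟩
  a % q ℕ.+ a / q ℕ.* q  <⟨ ℕ.+-monoˡ-< (a / q ℕ.* q) (m%n<n a q) ⟩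
  suc (a / q) ℕ.* q      ∎
  where open ℕ.≤-Reasoning

-- With P = (m choose 2) and K ≤ 2pm/q: K P q ≤ p m (m² − m) < p m³ ≤ E q.
pairs-bound : ∀ {K q p m P E} → K ℕ.* q ℕ.≤ 2 ℕ.* p ℕ.* m → 2 ℕ.* P ℕ.+ m ≡ m ℕ.* m →
              p ℕ.* m ^ 3 ℕ.≤ E ℕ.* q → 0 ℕ.< p ℕ.* m ℕ.* m → K ℕ.* P ℕ.< E
pairs-bound {K} {q} {p} {m} {P} {E} Kq≤2pm 2P+m≡m*m pm³≤Eq 0<pmm = ℕ.*-cancelʳ-< q (K ℕ.* P) E (begin-strict
  K ℕ.* P ℕ.* q                          ≡⟨ swap-factors K P q ⟩
  K ℕ.* q ℕ.* P                          ≤⟨ ℕ.*-monoˡ-≤ P Kq≤2pm ⟩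
  2 ℕ.* p ℕ.* m ℕ.* P                    <⟨ ℕ.m<m+n (2 ℕ.* p ℕ.* m ℕ.* P) 0<pmm ⟩
  2 ℕ.* p ℕ.* m ℕ.* P ℕ.+ p ℕ.* m ℕ.* m  ≡⟨ factor p m P ⟩
  p ℕ.* m ℕ.* (2 ℕ.* P ℕ.+ m)            ≡⟨ cong (p ℕ.* m ℕ.*_) 2P+m≡m*m ⟩
  p ℕ.* m ℕ.* (m ℕ.* m)                  ≡⟨ cube p m ⟩
  p ℕ.* m ^ 3                            ≤⟨ pm³≤Eq ⟩
  E ℕ.* q                                ∎)
  where
  open ℕ.≤-Reasoning
  swap-factors : ∀ K P q → K ℕ.* P ℕ.* q ≡ K ℕ.* q ℕ.* P
  swap-factors = solve-∀
  factor : ∀ p m P → 2 ℕ.* p ℕ.* m ℕ.* P ℕ.+ p ℕ.* m ℕ.* m ≡ p ℕ.* m ℕ.* (2 ℕ.* P ℕ.+ m)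
  factor = solve-∀
  cube : ∀ p m → p ℕ.* m ℕ.* (m ℕ.* m) ≡ p ℕ.* (m ℕ.* (m ℕ.* (m ℕ.* 1)))
  cube = solve-∀

path-length-bound : ∀ {p m q K} → 2 ℕ.* p ℕ.* m ℕ.< suc K ℕ.* q → 2 ℕ.* (p ℕ.* m ℕ.+ q) ℕ.≤ (3 ℕ.+ K) ℕ.* q
path-length-bound {p} {m} {q} {K} 2pm<[1+K]q = begin
  2 ℕ.* (p ℕ.* m ℕ.+ q)       ≡⟨ distrib p m q ⟩
  2 ℕ.* p ℕ.* m ℕ.+ 2 ℕ.* q   ≤⟨ ℕ.+-monoˡ-≤ (2 ℕ.* q) (ℕ.<⇒≤ 2pm<[1+K]q) ⟩
  suc K ℕ.* q ℕ.+ 2 ℕ.* q     ≡⟨ add-two K q ⟩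
  (3 ℕ.+ K) ℕ.* q             ∎
  where
  open ℕ.≤-Reasoning
  distrib : ∀ p m q → 2 ℕ.* (p ℕ.* m ℕ.+ q) ≡ 2 ℕ.* p ℕ.* m ℕ.+ 2 ℕ.* q
  distrib = solve-∀
  add-two : ∀ K q → suc K ℕ.* q ℕ.+ 2 ℕ.* q ≡ (3 ℕ.+ K) ℕ.* q
  add-two = solve-∀

Triple : ℕ → Set
Triple m = Fin m × Fin m × Fin m

module _ {m : ℕ} where

  open DecMembership (_≟_ {m}) using (_∈?_)

  _∈₃?_ : (v : Fin m) (e : Triple m) → Dec (v ∈₃ e)
  v ∈₃? (a , b , c) = (v ≟ a) ⊎-dec (v ≟ b) ⊎-dec (v ≟ c)

  ∈₃⇒∈ : {v a b c : Fin m} → v ∈₃ (a , b , c) → v ∈ a ∷ b ∷ c ∷ []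
  ∈₃⇒∈ (inj₁ v≡a)        = here v≡a
  ∈₃⇒∈ (inj₂ (inj₁ v≡b)) = there (here v≡b)
  ∈₃⇒∈ (inj₂ (inj₂ v≡c)) = there (there (here v≡c))

  ∈₃-trans : {v x y z : Fin m} {e : Triple m} → v ∈₃ (x , y , z) → x ∈₃ e → y ∈₃ e → z ∈₃ e → v ∈₃ e
  ∈₃-trans (inj₁ refl)        x∈ _  _  = x∈
  ∈₃-trans (inj₂ (inj₁ refl)) _  y∈ _  = y∈
  ∈₃-trans (inj₂ (inj₂ refl)) _  _  z∈ = z∈

  -- Four distinct vertices cannot lie in one triple.
  ∈₃-pigeonhole : {v x y z : Fin m} {e : Triple m} → Distinct₃ x y z →
                  x ∈₃ e → y ∈₃ e → z ∈₃ e → v ∈₃ e → v ∈₃ (x , y , z)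
  ∈₃-pigeonhole {v} {x} {y} {z} {a , b , c} (x≢y , y≢z , x≢z) x∈ y∈ z∈ v∈ with v ∈₃? (x , y , z)
  ... | yes v∈xyz = v∈xyz
  ... | no  v∉xyz = contradiction (Unique⇒length≤ vxyz! (∈₃⇒∈ v∈ ∷ ∈₃⇒∈ x∈ ∷ ∈₃⇒∈ y∈ ∷ ∈₃⇒∈ z∈ ∷ [])) ℕ.1+n≰n
    where
    vxyz! : Unique (v ∷ x ∷ y ∷ z ∷ [])
    vxyz! = (v∉xyz ∘ inj₁ ∷ v∉xyz ∘ inj₂ ∘ inj₁ ∷ v∉xyz ∘ inj₂ ∘ inj₂ ∷ [])
             ∷ (x≢y ∷ x≢z ∷ []) ∷ (y≢z ∷ []) ∷ [] ∷ []

  injective-on-∈₃ : {B : Set} (f : Fin m → B) {a b c u v : Fin m} → Distinct₃ (f a) (f b) (f c) →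
                    u ∈₃ (a , b , c) → v ∈₃ (a , b , c) → f u ≡ f v → u ≡ v
  injective-on-∈₃ f _            (inj₁ refl)        (inj₁ refl)        _  = refl
  injective-on-∈₃ f (ab , _ , _) (inj₁ refl)        (inj₂ (inj₁ refl)) eq = contradiction eq ab
  injective-on-∈₃ f (_ , _ , ac) (inj₁ refl)        (inj₂ (inj₂ refl)) eq = contradiction eq ac
  injective-on-∈₃ f (ab , _ , _) (inj₂ (inj₁ refl)) (inj₁ refl)        eq = contradiction (sym eq) ab
  injective-on-∈₃ f _            (inj₂ (inj₁ refl)) (inj₂ (inj₁ refl)) _  = refl
  injective-on-∈₃ f (_ , bc , _) (inj₂ (inj₁ refl)) (inj₂ (inj₂ refl)) eq = contradiction eq bc
  injective-on-∈₃ f (_ , _ , ac) (inj₂ (inj₂ refl)) (inj₁ refl)        eq = contradiction (sym eq) ac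
  injective-on-∈₃ f (_ , bc , _) (inj₂ (inj₂ refl)) (inj₂ (inj₁ refl)) eq = contradiction (sym eq) bc
  injective-on-∈₃ f _            (inj₂ (inj₂ refl)) (inj₂ (inj₂ refl)) _  = refl

  Sorted3⇒distinct : {a b c : Fin m} → Sorted3 (a , b , c) → Distinct₃ a b c
  Sorted3⇒distinct (a<b , b<c) = (λ { refl → ℕ.<-irrefl refl a<b })
                               , (λ { refl → ℕ.<-irrefl refl b<c })
                               , (λ { refl → ℕ.<-irrefl refl (ℕ.<-trans a<b b<c) })

  Sorted3-min : {a b c v : Fin m} → Sorted3 (a , b , c) → v ∈₃ (a , b , c) → toℕ a ℕ.≤ toℕ v
  Sorted3-min _           (inj₁ refl)        = ℕ.≤-refl
  Sorted3-min (a<b , _)   (inj₂ (inj₁ refl)) = ℕ.<⇒≤ a<b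
  Sorted3-min (a<b , b<c) (inj₂ (inj₂ refl)) = ℕ.<⇒≤ (ℕ.<-trans a<b b<c)

  Sorted3-max : {a b c v : Fin m} → Sorted3 (a , b , c) → v ∈₃ (a , b , c) → toℕ v ℕ.≤ toℕ c
  Sorted3-max (a<b , b<c) (inj₁ refl)        = ℕ.<⇒≤ (ℕ.<-trans a<b b<c)
  Sorted3-max (_ , b<c)   (inj₂ (inj₁ refl)) = ℕ.<⇒≤ b<c
  Sorted3-max _           (inj₂ (inj₂ refl)) = ℕ.≤-refl

  Sorted3-≡ : {e e′ : Triple m} → Sorted3 e → Sorted3 e′ → (∀ {v} → v ∈₃ e → v ∈₃ e′) → e ≡ e′
  Sorted3-≡ {a , b , c} {a′ , b′ , c′} s s′ e⊆e′ = cong₂ _,_ a≡a′ (cong₂ _,_ b≡b′ c≡c′)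
    where
    a≢b = proj₁ (Sorted3⇒distinct s)
    b≢c = proj₁ (proj₂ (Sorted3⇒distinct s))

    e′⊆e : ∀ {v} → v ∈₃ (a′ , b′ , c′) → v ∈₃ (a , b , c)
    e′⊆e v∈ = ∈₃-trans (∈₃-pigeonhole (Sorted3⇒distinct s) (e⊆e′ a∈) (e⊆e′ b∈) (e⊆e′ c∈) v∈) a∈ b∈ c∈
      where
      a∈ = inj₁ refl
      b∈ = inj₂ (inj₁ refl)
      c∈ = inj₂ (inj₂ refl)

    a≡a′ : a ≡ a′
    a≡a′ = toℕ-injective (ℕ.≤-antisym (Sorted3-min s (e′⊆e (inj₁ refl))) (Sorted3-min s′ (e⊆e′ (inj₁ refl))))

    c≡c′ : c ≡ c′
    c≡c′ = toℕ-injective (ℕ.≤-antisym (Sorted3-max s′ (e⊆e′ (inj₂ (inj₂ refl))))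
                                      (Sorted3-max s (e′⊆e (inj₂ (inj₂ refl)))))

    b≡b′ : b ≡ b′
    b≡b′ with e⊆e′ (inj₂ (inj₁ refl))
    ... | inj₁ b≡a′        = contradiction (trans a≡a′ (sym b≡a′)) a≢b
    ... | inj₂ (inj₁ b≡b′) = b≡b′
    ... | inj₂ (inj₂ b≡c′) = contradiction (trans b≡c′ (sym c≡c′)) b≢c

  Sorted3-determined : {x y z : Fin m} {e e′ : Triple m} → Sorted3 e → Sorted3 e′ → Distinct₃ x y z →
                       x ∈₃ e → y ∈₃ e → z ∈₃ e → x ∈₃ e′ → y ∈₃ e′ → z ∈₃ e′ → e ≡ e′
  Sorted3-determined s s′ xyz x∈e y∈e z∈e x∈e′ y∈e′ z∈e′ =
    Sorted3-≡ s s′ (λ v∈ → ∈₃-trans (∈₃-pigeonhole xyz x∈e y∈e z∈e v∈) x∈e′ y∈e′ z∈e′)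

  apex : Fin m → Fin m → Triple m → Fin m
  apex y x (a , b , c) with a ∈? y ∷ x ∷ [] | b ∈? y ∷ x ∷ []
  ... | no _  | _     = a
  ... | yes _ | no _  = b
  ... | yes _ | yes _ = c

  apex-spec : {y x : Fin m} {e : Triple m} → Sorted3 e → apex y x e ∈₃ e × apex y x e ∉ y ∷ x ∷ []
  apex-spec {y} {x} {a , b , c} s with a ∈? y ∷ x ∷ [] | b ∈? y ∷ x ∷ []
  ... | no a∉  | _      = inj₁ refl , a∉
  ... | yes _  | no b∉  = inj₂ (inj₁ refl) , b∉
  ... | yes a∈ | yes b∈ = inj₂ (inj₂ refl) , λ c∈ → ℕ.1+n≰n (Unique⇒length≤ abc! (a∈ ∷ b∈ ∷ c∈ ∷ []))
    where
    abc! : Unique (a ∷ b ∷ c ∷ [])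
    abc! = let a≢b , b≢c , a≢c = Sorted3⇒distinct s in (a≢b ∷ a≢c ∷ []) ∷ (b≢c ∷ []) ∷ [] ∷ []

  -- Codegrees

  Contains₂ : Fin m → Fin m → Triple m → Set
  Contains₂ x y e = x ∈₃ e × y ∈₃ e

  contains₂? : (x y : Fin m) → Decidable (Contains₂ x y)
  contains₂? x y e = (x ∈₃? e) ×-dec (y ∈₃? e)

  apex-injective : {y x : Fin m} {e e′ : Triple m} → y ≢ x → Sorted3 e → Sorted3 e′ →
                   Contains₂ y x e → Contains₂ y x e′ → apex y x e ≡ apex y x e′ → e ≡ e′
  apex-injective y≢x s s′ (y∈e , x∈e) (y∈e′ , x∈e′) same-apex =
    let z∈e , z∉yx = apex-spec s
        z′∈e′ , _  = apex-spec s′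
    in Sorted3-determined s s′ (z∉yx ∘ here , y≢x , z∉yx ∘ there ∘ here)
                          z∈e y∈e x∈e (subst (_∈₃ _) (sym same-apex) z′∈e′) y∈e′ x∈e′

  codegree : Fin m → Fin m → List (Triple m) → ℕ
  codegree x y R = length (filter (contains₂? x y) R)

  codegree-comm : ∀ x y R → codegree x y R ≡ codegree y x R
  codegree-comm x y R = cong length (filter-≐ (contains₂? x y) (contains₂? y x) (swap , swap) R)

  -- Distinct edges through {y , x} have distinct apices, so there are more apices than vertices in vs.
  fresh-apex : {y x : Fin m} {R : List (Triple m)} → All Sorted3 R → Unique R → y ≢ x →
               (vs : List (Fin m)) → length vs ℕ.< codegree y x R →
               ∃[ e ] e ∈ R × Contains₂ y x e × apex y x e ∉ vs
  fresh-apex {y} {x} {R} R-sorted R! y≢x vs vs<codegree =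
    let z , z∈apexes , z∉vs = Unique⇒∃∉ _≟_ apexes!
                                 (subst (length vs ℕ.<_) (sym (length-map (apex y x) through)) vs<codegree)
        e , e∈through , z≡apex = ∈-map⁻ (apex y x) z∈apexes
        e∈R , yx∈e = ∈-filter⁻ (contains₂? y x) e∈through
    in e , e∈R , yx∈e , subst (_∉ vs) z≡apex z∉vs
    where
    through = filter (contains₂? y x) R
    apexes! : Unique (map (apex y x) through)
    apexes! = Unique-map⁺ (λ (s , yx∈e) (s′ , yx∈e′) → apex-injective y≢x s s′ yx∈e yx∈e′)
                          (All.zip (All.filter⁺ (contains₂? y x) R-sorted , all-filter (contains₂? y x) R))
                          (Unique.filter⁺ (contains₂? y x) R!)

  removePair : Fin m → Fin m → List (Triple m) → List (Triple m)
  removePair x y = filter (∁? (contains₂? x y))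

  length-removePair : ∀ x y R → codegree x y R ℕ.+ length (removePair x y R) ≡ length R
  length-removePair x y = length-filter+∁ (contains₂? x y)

  codegree-removePair-≤ : ∀ u v x y R → codegree u v (removePair x y R) ℕ.≤ codegree u v R
  codegree-removePair-≤ u v x y R =
    length-mono-≤ (Sublist.filter⁺ (contains₂? u v) (contains₂? u v) (λ { refl uv∈e → uv∈e }) (Sublist.filter-⊆ _ R))

  codegree-removePair-self : ∀ x y R → codegree x y (removePair x y R) ≡ 0
  codegree-removePair-self x y R =
    cong length (filter-none (contains₂? x y) (all-filter (∁? (contains₂? x y)) R))

  PairPositive : List (Triple m) → Fin m × Fin m → Set
  PairPositive R (x , y) = 0 ℕ.< codegree x y R

  pairPositive? : (R : List (Triple m)) → Decidable (PairPositive R)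
  pairPositive? R (x , y) = 0 ℕ.<? codegree x y R

  positivePairs : List (Triple m) → ℕ
  positivePairs R = length (filter (pairPositive? R) (unorderedPairs (allFin m)))

  positivePairs-removePair : ∀ {x y} R → (x , y) ∈ unorderedPairs (allFin m) → 0 ℕ.< codegree x y R →
                             positivePairs (removePair x y R) ℕ.< positivePairs R
  positivePairs-removePair {x} {y} R xy∈ xy-positive =
    length-filter-< (pairPositive? (removePair x y R)) (pairPositive? R)
      (λ {(u , v)} → λ uv-positive → ℕ.<-≤-trans uv-positive (codegree-removePair-≤ u v x y R))
      (lose xy∈ (xy-positive , λ xy-positive′ → ℕ.<-irrefl (sym (codegree-removePair-self x y R)) xy-positive′))

-- Long tight paths

module _ {m : ℕ} (H : Hypergraph3 m) where

  record EdgeSubset (R : List (Triple m)) : Set where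
    field
      ⊆-edges : All (_∈ edges H) R
      sorted  : All Sorted3 R
      unique  : Unique R

  edges-EdgeSubset : EdgeSubset (edges H)
  edges-EdgeSubset = record { ⊆-edges = All.tabulate id ; sorted = edgesSorted H ; unique = edgesUnique H }

  removePair-EdgeSubset : ∀ {R} x y → EdgeSubset R → EdgeSubset (removePair x y R)
  removePair-EdgeSubset x y R-sub = record
    { ⊆-edges = All.filter⁺ (∁? (contains₂? x y)) ⊆-edges
    ; sorted  = All.filter⁺ (∁? (contains₂? x y)) sorted
    ; unique  = Unique.filter⁺ (∁? (contains₂? x y)) unique
    }
    where open EdgeSubset R-sub

  module _ (K : ℕ) where

    CodegreeAbove : List (Triple m) → Set
    CodegreeAbove R = ∀ x y → x ≢ y → 0 ℕ.< codegree x y R → K ℕ.< codegree x y R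

    LowPair : List (Triple m) → Fin m × Fin m → Set
    LowPair R (x , y) = 0 ℕ.< codegree x y R × codegree x y R ℕ.≤ K

    lowPair? : (R : List (Triple m)) → Decidable (LowPair R)
    lowPair? R (x , y) = (0 ℕ.<? codegree x y R) ×-dec (codegree x y R ℕ.≤? K)

    noLowPair⇒CodegreeAbove : ∀ {R} → All (¬_ ∘ LowPair R) (unorderedPairs (allFin m)) → CodegreeAbove R
    noLowPair⇒CodegreeAbove {R} no-low x y x≢y positive with ∈-unorderedPairs (∈-allFin x) (∈-allFin y) x≢y
    ... | inj₁ xy∈ = ℕ.≰⇒> λ ≤K → All.lookup no-low xy∈ (positive , ≤K)
    ... | inj₂ yx∈ = ℕ.≰⇒> λ ≤K → All.lookup no-low yx∈
                       (subst (0 ℕ.<_) (codegree-comm x y R) positive , subst (ℕ._≤ K) (codegree-comm x y R) ≤K)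

    -- Deleting the edges through a low pair removes at most K edges and kills one positive pair,
    -- so the invariant K · positivePairs R < |R| survives and eventually no low pair is left.
    prune : ∀ R → Acc ℕ._<_ (positivePairs R) → EdgeSubset R → K ℕ.* positivePairs R ℕ.< length R →
            ∃[ R′ ] EdgeSubset R′ × CodegreeAbove R′ × ∃[ e ] e ∈ R′
    prune []      _         _     ()
    prune (e ∷ R) (acc rec) R-sub bound with any? (lowPair? (e ∷ R)) (unorderedPairs (allFin m))
    ... | no no-low = e ∷ R , R-sub , noLowPair⇒CodegreeAbove {e ∷ R} (¬Any⇒All¬ _ no-low) , e , here refl
    ... | yes some-low with find some-low
    ...   | (x , y) , xy∈ , (positive , ≤K) =
      prune (removePair x y (e ∷ R)) (rec fewer) (removePair-EdgeSubset x y R-sub)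
            (bound-after-removal ≤K fewer (subst (K ℕ.* positivePairs (e ∷ R) ℕ.<_) (sym (length-removePair x y (e ∷ R))) bound))
      where
      fewer : positivePairs (removePair x y (e ∷ R)) ℕ.< positivePairs (e ∷ R)
      fewer = positivePairs-removePair (e ∷ R) xy∈ positive

    module _ {R : List (Triple m)} (R-sub : EdgeSubset R) (R-above : CodegreeAbove R) where

      open EdgeSubset R-sub

      -- Paths grow at the front: u₀ is the newest vertex.
      record GrowingPath : Set where
        field
          u₀ u₁         : Fin m
          rest          : List (Fin m)
          path-unique   : Unique (u₀ ∷ u₁ ∷ rest)
          path-edges    : ConsecutiveEdges H (u₀ ∷ u₁ ∷ rest)
          head-codegree : 0 ℕ.< codegree u₀ u₁ R
      open GrowingPath

      initialPath : ∀ {e} → e ∈ R → GrowingPath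
      initialPath {a , b , c} e∈R with Sorted3⇒distinct (All.lookup sorted e∈R)
      ... | a≢b , b≢c , a≢c = record
        { u₀ = a ; u₁ = b ; rest = c ∷ []
        ; path-unique   = (a≢b ∷ a≢c ∷ []) ∷ (b≢c ∷ []) ∷ [] ∷ []
        ; path-edges    = (a≢b , b≢c , a≢c , lose (All.lookup ⊆-edges e∈R) (a∈ , b∈ , c∈)) , tt
        ; head-codegree = filter-some (contains₂? a b) (lose e∈R (a∈ , b∈))
        }
        where
        a∈ = inj₁ refl
        b∈ = inj₂ (inj₁ refl)
        c∈ = inj₂ (inj₂ refl)

      head-distinct : (P : GrowingPath) → u₀ P ≢ u₁ P
      head-distinct P = All.head (AllPairs.head (path-unique P))

      extendThrough : (P : GrowingPath) → ∀ {e} → e ∈ R → Contains₂ (u₀ P) (u₁ P) e →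
                      apex (u₀ P) (u₁ P) e ∉ rest P → GrowingPath
      extendThrough P {e} e∈R (y∈e , x∈e) z∉rest = record
        { u₀ = z ; u₁ = u₀ P ; rest = u₁ P ∷ rest P
        ; path-unique   = (z≢y ∷ z≢x ∷ ¬Any⇒All¬ (rest P) z∉rest) ∷ path-unique P
        ; path-edges    = (z≢y , y≢x , z≢x , lose (All.lookup ⊆-edges e∈R) (z∈e , y∈e , x∈e)) , path-edges P
        ; head-codegree = filter-some (contains₂? z (u₀ P)) (lose e∈R (z∈e , y∈e))
        }
        where
        z = apex (u₀ P) (u₁ P) e
        z∈e : z ∈₃ e
        z∈e = proj₁ (apex-spec (All.lookup sorted e∈R))
        y≢x = head-distinct P
        z∉yx : z ∉ u₀ P ∷ u₁ P ∷ []
        z∉yx = proj₂ (apex-spec (All.lookup sorted e∈R))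
        z≢y : z ≢ u₀ P
        z≢y = z∉yx ∘ here
        z≢x : z ≢ u₁ P
        z≢x = z∉yx ∘ there ∘ here

      -- More than K ≥ |rest| edges pass through {u₀ , u₁}, so one of them brings a new vertex.
      extend : (P : GrowingPath) → length (rest P) ℕ.≤ K → Σ GrowingPath λ P′ → length (rest P′) ≡ suc (length (rest P))
      extend P rest≤K =
        let _ , e∈R , yx∈e , z∉rest = fresh-apex sorted unique (head-distinct P) (rest P)
                                        (ℕ.≤-<-trans rest≤K (R-above _ _ (head-distinct P) (head-codegree P)))
        in extendThrough P e∈R yx∈e z∉rest , refl

      grow : ∀ {e} → e ∈ R → ∀ n → n ℕ.≤ K → Σ GrowingPath λ P → length (rest P) ≡ suc n
      grow e∈R zero    _   = initialPath e∈R , refl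
      grow e∈R (suc n) n<K =
        let P , |P|≡ = grow e∈R n (ℕ.<⇒≤ n<K)
            P′ , |P′|≡ = extend P (subst (ℕ._≤ K) (sym |P|≡) n<K)
        in P′ , trans |P′|≡ (cong suc |P|≡)

    tightPath-of-length : K ℕ.* length (unorderedPairs (allFin m)) ℕ.< ∣E∣ H →
                          ∃[ P ] length (vertices {H = H} P) ≡ 3 ℕ.+ K
    tightPath-of-length few-pairs =
      let R , R-sub , R-above , e , e∈R = prune (edges H) (<-wellFounded _) edges-EdgeSubset
            (ℕ.≤-<-trans (ℕ.*-monoʳ-≤ K (length-filter (pairPositive? (edges H)) (unorderedPairs (allFin m)))) few-pairs)
          P , |P|≡ = grow R-sub R-above e∈R K ℕ.≤-refl
          open GrowingPath P
      in record { vertices = u₀ ∷ u₁ ∷ rest ; distinct = path-unique ; tight = path-edges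
                ; atLeast3 = s≤s (s≤s (subst (1 ℕ.≤_) (sym |P|≡) (s≤s z≤n))) }
         , cong (λ n → suc (suc n)) |P|≡

-- Copies of M in 3-partite hypergraphs

Fin3-∈₃ : (k : Fin 3) → k ∈₃ (zero , suc zero , suc (suc zero))
Fin3-∈₃ zero             = inj₁ refl
Fin3-∈₃ (suc zero)       = inj₂ (inj₁ refl)
Fin3-∈₃ (suc (suc zero)) = inj₂ (inj₂ refl)

Distinct₃⇒cover : {p q r : Fin 3} → Distinct₃ p q r → (k : Fin 3) → k ∈₃ (p , q , r)
Distinct₃⇒cover pqr k = ∈₃-pigeonhole pqr (Fin3-∈₃ _) (Fin3-∈₃ _) (Fin3-∈₃ _) (Fin3-∈₃ k)

Distinct₃-period : {p₀ p₁ p₂ p₃ : Fin 3} → Distinct₃ p₀ p₁ p₂ → Distinct₃ p₁ p₂ p₃ → p₃ ≡ p₀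
Distinct₃-period {p₃ = p₃} p₀p₁p₂ (_ , p₂≢p₃ , p₁≢p₃) with Distinct₃⇒cover p₀p₁p₂ p₃
... | inj₁ p₃≡p₀        = p₃≡p₀
... | inj₂ (inj₁ p₃≡p₁) = contradiction (sym p₃≡p₁) p₁≢p₃
... | inj₂ (inj₂ p₃≡p₂) = contradiction (sym p₃≡p₂) p₂≢p₃

occurrences : (Fin 8 → Fin 3) → Fin 3 → ℕ
occurrences f k = length (filter (λ j → f j ≟ k) (allFin 8))

occurrences-cong : ∀ {f g} → (∀ j → f j ≡ g j) → ∀ k → occurrences f k ≡ occurrences g k
occurrences-cong f≗g k = cong length (filter-≐ (λ j → _ ≟ k) (λ j → _ ≟ k)
  ((λ {j} fj≡k → trans (sym (f≗g j)) fj≡k) , (λ {j} gj≡k → trans (f≗g j) gj≡k)) (allFin 8))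

-- The colouring of eight consecutive vertices of a tight path in a 3-partite hypergraph.
periodicColouring : Fin 3 → Fin 3 → Fin 3 → Fin 8 → Fin 3
periodicColouring p₀ p₁ p₂ = lookup (p₀ ∷ p₁ ∷ p₂ ∷ p₀ ∷ p₁ ∷ p₂ ∷ p₀ ∷ p₁ ∷ [])

occurrences-periodicColouring : ∀ p₀ p₁ p₂ → Distinct₃ p₀ p₁ p₂ →
  occurrences (periodicColouring p₀ p₁ p₂) p₂ ≡ 2 ×
  (∀ k → k ≢ p₂ → occurrences (periodicColouring p₀ p₁ p₂) k ≡ 3)
occurrences-periodicColouring = from-yes
  (all? λ p₀ → all? λ p₁ → all? λ p₂ →
    (¬? (p₀ ≟ p₁) ×-dec ¬? (p₁ ≟ p₂) ×-dec ¬? (p₀ ≟ p₂)) →-dec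
      (occurrences (periodicColouring p₀ p₁ p₂) p₂ ℕ.≟ 2) ×-dec
      all? λ k → ¬? (k ≟ p₂) →-dec (occurrences (periodicColouring p₀ p₁ p₂) k ℕ.≟ 3))

module _ {m : ℕ} {H : Hypergraph3 m} {part : Fin m → Fin 3} (H-3partite : ThreePartite H part) where

  IsEdge⇒Distinct₃-parts : ∀ {x y z} → IsEdge H x y z → Distinct₃ (part x) (part y) (part z)
  IsEdge⇒Distinct₃-parts (x≢y , y≢z , x≢z , in-edge) with find in-edge
  ... | e , e∈ , x∈ , y∈ , z∈ =
    x≢y ∘ injective-on-e x∈ y∈ , y≢z ∘ injective-on-e y∈ z∈ , x≢z ∘ injective-on-e x∈ z∈
    where
    injective-on-e : ∀ {u v} → u ∈₃ e → v ∈₃ e → part u ≡ part v → u ≡ v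
    injective-on-e = injective-on-∈₃ part (All.lookup H-3partite e∈)

  part-period : ∀ {x y z w} → IsEdge H x y z → IsEdge H y z w → part w ≡ part x
  part-period xyz yzw = Distinct₃-period (IsEdge⇒Distinct₃-parts xyz) (IsEdge⇒Distinct₃-parts yzw)

  -- Classes repeat with period 3 along the window, so w₂ , w₅ share a class and the other six split 3 + 3.
  copyOfM : ∀ {w₀ w₁ w₂ w₃ w₄ w₅ w₆ w₇ rest} →
            Unique (w₀ ∷ w₁ ∷ w₂ ∷ w₃ ∷ w₄ ∷ w₅ ∷ w₆ ∷ w₇ ∷ rest) →
            ConsecutiveEdges H (w₀ ∷ w₁ ∷ w₂ ∷ w₃ ∷ w₄ ∷ w₅ ∷ w₆ ∷ w₇ ∷ rest) →
            ∃[ C ] meetCount {H = H} part C (part w₂) ≡ 2 × (∀ k → k ≢ part w₂ → meetCount {H = H} part C k ≡ 3)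
  copyOfM {w₀} {w₁} {w₂} {w₃} {w₄} {w₅} {w₆} {w₇} ws! (e₀ , e₁ , e₂ , e₃ , e₄ , e₅ , _) =
    C , trans (occurrences-cong colours (part w₂)) (proj₁ counts)
      , λ k k≢w₂ → trans (occurrences-cong colours k) (proj₂ counts k k≢w₂)
    where
    window = w₀ ∷ w₁ ∷ w₂ ∷ w₃ ∷ w₄ ∷ w₅ ∷ w₆ ∷ w₇ ∷ []

    C : CopyOfM H
    C = record { emb = lookup window ; injective = lookup-injective (Unique.take⁺ 8 ws!)
               ; edgesMap = e₀ ∷ e₂ ∷ e₃ ∷ e₅ ∷ [] }

    colours : ∀ j → part (lookup window j) ≡ periodicColouring (part w₀) (part w₁) (part w₂) j
    colours zero                                      = refl
    colours (suc zero)                                = refl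
    colours (suc (suc zero))                          = refl
    colours (suc (suc (suc zero)))                    = part-period e₀ e₁
    colours (suc (suc (suc (suc zero))))              = part-period e₁ e₂
    colours (suc (suc (suc (suc (suc zero)))))        = part-period e₂ e₃
    colours (suc (suc (suc (suc (suc (suc zero))))))  = trans (part-period e₃ e₄) (part-period e₀ e₁)
    colours (suc (suc (suc (suc (suc (suc (suc zero))))))) = trans (part-period e₄ e₅) (part-period e₁ e₂)

    counts = occurrences-periodicColouring (part w₀) (part w₁) (part w₂) (IsEdge⇒Distinct₃-parts e₀)

  copyOfM-in-path : ∀ vs → 10 ℕ.≤ length vs → Unique vs → ConsecutiveEdges H vs → (i : Fin 3) →
                    ∃[ C ] meetCount {H = H} part C i ≡ 2 × (∀ k → k ≢ i → meetCount {H = H} part C k ≡ 3)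
  copyOfM-in-path (v₀ ∷ v₁ ∷ v₂ ∷ v₃ ∷ v₄ ∷ v₅ ∷ v₆ ∷ v₇ ∷ v₈ ∷ v₉ ∷ rest) _ vs! vs-edges i
    with Distinct₃⇒cover (IsEdge⇒Distinct₃-parts (proj₁ (proj₂ (proj₂ vs-edges)))) i
  ... | inj₁ refl        = copyOfM vs! vs-edges
  ... | inj₂ (inj₁ refl) = copyOfM (AllPairs.tail vs!) (proj₂ vs-edges)
  ... | inj₂ (inj₂ refl) = copyOfM (AllPairs.tail (AllPairs.tail vs!)) (proj₂ (proj₂ vs-edges))
  copyOfM-in-path [] () _ _ _
  copyOfM-in-path (_ ∷ []) (s≤s ()) _ _ _
  copyOfM-in-path (_ ∷ _ ∷ []) (s≤s (s≤s ())) _ _ _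
  copyOfM-in-path (_ ∷ _ ∷ _ ∷ []) (s≤s (s≤s (s≤s ()))) _ _ _
  copyOfM-in-path (_ ∷ _ ∷ _ ∷ _ ∷ []) (s≤s (s≤s (s≤s (s≤s ())))) _ _ _
  copyOfM-in-path (_ ∷ _ ∷ _ ∷ _ ∷ _ ∷ []) (s≤s (s≤s (s≤s (s≤s (s≤s ()))))) _ _ _
  copyOfM-in-path (_ ∷ _ ∷ _ ∷ _ ∷ _ ∷ _ ∷ []) (s≤s (s≤s (s≤s (s≤s (s≤s (s≤s ())))))) _ _ _
  copyOfM-in-path (_ ∷ _ ∷ _ ∷ _ ∷ _ ∷ _ ∷ _ ∷ []) (s≤s (s≤s (s≤s (s≤s (s≤s (s≤s (s≤s ()))))))) _ _ _
  copyOfM-in-path (_ ∷ _ ∷ _ ∷ _ ∷ _ ∷ _ ∷ _ ∷ _ ∷ []) (s≤s (s≤s (s≤s (s≤s (s≤s (s≤s (s≤s (s≤s ())))))))) _ _ _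
  copyOfM-in-path (_ ∷ _ ∷ _ ∷ _ ∷ _ ∷ _ ∷ _ ∷ _ ∷ _ ∷ []) (s≤s (s≤s (s≤s (s≤s (s≤s (s≤s (s≤s (s≤s (s≤s ()))))))))) _ _ _

-- fracᵘ a b is the fraction a / (1 + b).
fracᵘ : ℕ → ℕ → ℚᵘ
fracᵘ a b = mkℚᵘ (+ a) b

toℚᵘ-ℕtoℚ : ∀ n → toℚᵘ (ℕtoℚ n) ≡ fracᵘ n 0
toℚᵘ-ℕtoℚ n = cong toℚᵘ (normalize-coprime (coprime-sym (1-coprimeTo n)))

fracᵘ-* : ∀ a b c d → fracᵘ a b ℚᵘ.* fracᵘ c d ≡ fracᵘ (a ℕ.* c) (d ℕ.+ b ℕ.* suc d)
fracᵘ-* a b c d = cong (λ n → mkℚᵘ n _) (sym (ℤ.pos-* a c))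

fracᵘ-+ : ∀ a b c d → fracᵘ a b ℚᵘ.+ fracᵘ c d ≡ fracᵘ (a ℕ.* suc d ℕ.+ c ℕ.* suc b) (d ℕ.+ b ℕ.* suc d)
fracᵘ-+ a b c d = cong (λ n → mkℚᵘ n _) (cong₂ ℤ._+_ (sym (ℤ.pos-* a (suc d))) (sym (ℤ.pos-* c (suc b))))

module _ {x y : ℚ} {a b c d : ℕ} (x≃ : toℚᵘ x ≃ fracᵘ a b) (y≃ : toℚᵘ y ≃ fracᵘ c d) where

  ≤⇒cross-≤ : x ≤ y → a ℕ.* suc d ℕ.≤ c ℕ.* suc b
  ≤⇒cross-≤ x≤y with ℚᵘ.≤-respˡ-≃ x≃ (ℚᵘ.≤-respʳ-≃ y≃ (toℚᵘ-mono-≤ x≤y))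
  ... | ℚᵘ.*≤* ad≤cb = ℤ.drop‿+≤+ (subst₂ ℤ._≤_ (sym (ℤ.pos-* a (suc d))) (sym (ℤ.pos-* c (suc b))) ad≤cb)

  <⇒cross-< : x < y → a ℕ.* suc d ℕ.< c ℕ.* suc b
  <⇒cross-< x<y with ℚᵘ.<-respˡ-≃ x≃ (ℚᵘ.<-respʳ-≃ y≃ (toℚᵘ-mono-< x<y))
  ... | ℚᵘ.*<* ad<cb = ℤ.drop‿+<+ (subst₂ ℤ._<_ (sym (ℤ.pos-* a (suc d))) (sym (ℤ.pos-* c (suc b))) ad<cb)

  cross-≤⇒≤ : a ℕ.* suc d ℕ.≤ c ℕ.* suc b → x ≤ y
  cross-≤⇒≤ ad≤cb = toℚᵘ-cancel-≤ (ℚᵘ.≤-respˡ-≃ (ℚᵘ.≃-sym x≃) (ℚᵘ.≤-respʳ-≃ (ℚᵘ.≃-sym y≃)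
    (ℚᵘ.*≤* (subst₂ ℤ._≤_ (ℤ.pos-* a (suc d)) (ℤ.pos-* c (suc b)) (ℤ.+≤+ ad≤cb)))))

module Fraction (p q₁ : ℕ) .(p⊥q : Coprime p (suc q₁)) where

  private
    d : ℚ
    d = mkℚ (+ p) q₁ p⊥q

  toℚᵘ-d*ℕtoℚ : ∀ n → toℚᵘ (d * ℕtoℚ n) ≃ fracᵘ (p ℕ.* n) q₁
  toℚᵘ-d*ℕtoℚ n = ℚᵘ.≃-trans (toℚᵘ-homo-* d (ℕtoℚ n)) (ℚᵘ.≃-reflexive (begin
    toℚᵘ d ℚᵘ.* toℚᵘ (ℕtoℚ n)  ≡⟨ cong (toℚᵘ d ℚᵘ.*_) (toℚᵘ-ℕtoℚ n) ⟩
    fracᵘ p q₁ ℚᵘ.* fracᵘ n 0  ≡⟨ fracᵘ-* p q₁ n 0 ⟩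
    fracᵘ (p ℕ.* n) (q₁ ℕ.* 1) ≡⟨ cong (fracᵘ (p ℕ.* n)) (ℕ.*-identityʳ q₁) ⟩
    fracᵘ (p ℕ.* n) q₁         ∎))
    where open ≡-Reasoning

  toℚᵘ-2*d*ℕtoℚ : ∀ n → toℚᵘ (ℕtoℚ 2 * d * ℕtoℚ n) ≃ fracᵘ (2 ℕ.* p ℕ.* n) q₁
  toℚᵘ-2*d*ℕtoℚ n = ℚᵘ.≃-trans (toℚᵘ-homo-* (ℕtoℚ 2 * d) (ℕtoℚ n))
    (ℚᵘ.≃-trans (ℚᵘ.*-congʳ (toℚᵘ-homo-* (ℕtoℚ 2) d)) (ℚᵘ.≃-reflexive (begin
      toℚᵘ (ℕtoℚ 2) ℚᵘ.* toℚᵘ d ℚᵘ.* toℚᵘ (ℕtoℚ n)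
        ≡⟨ cong₂ (λ u v → u ℚᵘ.* toℚᵘ d ℚᵘ.* v) (toℚᵘ-ℕtoℚ 2) (toℚᵘ-ℕtoℚ n) ⟩
      fracᵘ 2 0 ℚᵘ.* fracᵘ p q₁ ℚᵘ.* fracᵘ n 0
        ≡⟨ cong (ℚᵘ._* fracᵘ n 0) (fracᵘ-* 2 0 p q₁) ⟩
      fracᵘ (2 ℕ.* p) (q₁ ℕ.+ 0) ℚᵘ.* fracᵘ n 0
        ≡⟨ fracᵘ-* (2 ℕ.* p) (q₁ ℕ.+ 0) n 0 ⟩
      fracᵘ (2 ℕ.* p ℕ.* n) ((q₁ ℕ.+ 0) ℕ.* 1)
        ≡⟨ cong (fracᵘ (2 ℕ.* p ℕ.* n)) (trans (ℕ.*-identityʳ (q₁ ℕ.+ 0)) (ℕ.+-identityʳ q₁)) ⟩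
      fracᵘ (2 ℕ.* p ℕ.* n) q₁ ∎)))
    where open ≡-Reasoning

  toℚᵘ-2*[d*ℕtoℚ+1] : ∀ n → toℚᵘ (ℕtoℚ 2 * (d * ℕtoℚ n + 1ℚ)) ≃ fracᵘ (2 ℕ.* (p ℕ.* n ℕ.+ suc q₁)) q₁
  toℚᵘ-2*[d*ℕtoℚ+1] n = ℚᵘ.≃-trans (toℚᵘ-homo-* (ℕtoℚ 2) (d * ℕtoℚ n + 1ℚ))
    (ℚᵘ.≃-trans (ℚᵘ.*-cong (ℚᵘ.≃-reflexive (toℚᵘ-ℕtoℚ 2))
                           (ℚᵘ.≃-trans (toℚᵘ-homo-+ (d * ℕtoℚ n) 1ℚ) (ℚᵘ.+-congˡ (toℚᵘ 1ℚ) (toℚᵘ-d*ℕtoℚ n))))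
                (ℚᵘ.≃-reflexive (begin
      fracᵘ 2 0 ℚᵘ.* (fracᵘ (p ℕ.* n) q₁ ℚᵘ.+ fracᵘ 1 0)
        ≡⟨ cong (fracᵘ 2 0 ℚᵘ.*_) (fracᵘ-+ (p ℕ.* n) q₁ 1 0) ⟩
      fracᵘ 2 0 ℚᵘ.* fracᵘ (p ℕ.* n ℕ.* 1 ℕ.+ 1 ℕ.* suc q₁) (q₁ ℕ.* 1)
        ≡⟨ fracᵘ-* 2 0 (p ℕ.* n ℕ.* 1 ℕ.+ 1 ℕ.* suc q₁) (q₁ ℕ.* 1) ⟩
      fracᵘ (2 ℕ.* (p ℕ.* n ℕ.* 1 ℕ.+ 1 ℕ.* suc q₁)) (q₁ ℕ.* 1 ℕ.+ 0)
        ≡⟨ cong₂ fracᵘ (cong (2 ℕ.*_) (cong₂ ℕ._+_ (ℕ.*-identityʳ (p ℕ.* n)) (ℕ.*-identityˡ (suc q₁))))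
                       (trans (ℕ.+-identityʳ (q₁ ℕ.* 1)) (ℕ.*-identityʳ q₁)) ⟩
      fracᵘ (2 ℕ.* (p ℕ.* n ℕ.+ suc q₁)) q₁ ∎)))
    where open ≡-Reasoning

  d*ℕtoℚ-≤ : ∀ n e → d * ℕtoℚ n ≤ ℕtoℚ e → p ℕ.* n ℕ.≤ e ℕ.* suc q₁
  d*ℕtoℚ-≤ n e dn≤e = subst (ℕ._≤ e ℕ.* suc q₁) (ℕ.*-identityʳ (p ℕ.* n))
    (≤⇒cross-≤ (toℚᵘ-d*ℕtoℚ n) (ℚᵘ.≃-reflexive (toℚᵘ-ℕtoℚ e)) dn≤e)

  <-2*d*ℕtoℚ : ∀ n e → ℕtoℚ e < ℕtoℚ 2 * d * ℕtoℚ n → e ℕ.* suc q₁ ℕ.< 2 ℕ.* p ℕ.* n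
  <-2*d*ℕtoℚ n e e<2dn = subst (e ℕ.* suc q₁ ℕ.<_) (ℕ.*-identityʳ (2 ℕ.* p ℕ.* n))
    (<⇒cross-< (ℚᵘ.≃-reflexive (toℚᵘ-ℕtoℚ e)) (toℚᵘ-2*d*ℕtoℚ n) e<2dn)

  2*[d*ℕtoℚ+1]-≤ : ∀ n e → 2 ℕ.* (p ℕ.* n ℕ.+ suc q₁) ℕ.≤ e ℕ.* suc q₁ →
                   ℕtoℚ 2 * (d * ℕtoℚ n + 1ℚ) ≤ ℕtoℚ e
  2*[d*ℕtoℚ+1]-≤ n e h = cross-≤⇒≤ (toℚᵘ-2*[d*ℕtoℚ+1] n) (ℚᵘ.≃-reflexive (toℚᵘ-ℕtoℚ e))
    (subst (ℕ._≤ e ℕ.* suc q₁) (sym (ℕ.*-identityʳ _)) h)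

proposition3p2 :
    (m : ℕ) → .{{_ : NonZero m}} → (d : ℚ) → 0ℚ < d →
    (H : Hypergraph3 m) → d * ℕtoℚ (m ^ 3) ≤ ℕtoℚ (∣E∣ H) →
      (∃[ P ] (ℕtoℚ 2 * (d * ℕtoℚ m + 1ℚ) ≤ ℕtoℚ (length (vertices {H = H} P))))
      × ((part : Fin m → Fin 3) → ThreePartite H part →
         ℕtoℚ 10 < ℕtoℚ 2 * d * ℕtoℚ m →
         (i : Fin 3) → ∃[ C ] ((meetCount {H = H} part C i ≡ 2)
                               × ((k : Fin 3) → k ≢ i → meetCount {H = H} part C k ≡ 3)))
proposition3p2 m (mkℚ -[1+ _ ] _ _) (*<* ()) _ _
proposition3p2 m (mkℚ (+ 0) _ _)    (*<* (ℤ.+<+ ())) _ _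
proposition3p2 m d@(mkℚ (+ suc p′) q₁ p⊥q) _ H dm³≤E =
  let P , |P|≡3+K = tightPath-of-length H K few-edges-per-pair
  in (P , subst (λ n → ℕtoℚ 2 * (d * ℕtoℚ m + 1ℚ) ≤ ℕtoℚ n) (sym |P|≡3+K) long-enough)
   , λ part H-3partite 10<2dm → copyOfM-in-path H-3partite (vertices P)
       (subst (10 ℕ.≤_) (sym |P|≡3+K) (ten≤3+K 10<2dm)) (distinct P) (tight P)
  where
  p = suc p′
  q = suc q₁
  K = (2 ℕ.* p ℕ.* m) / q
  open Fraction p q₁ p⊥q

  2pm<[1+K]q : 2 ℕ.* p ℕ.* m ℕ.< suc K ℕ.* q
  2pm<[1+K]q = m<[1+m/n]*n (2 ℕ.* p ℕ.* m) q

  few-edges-per-pair : K ℕ.* length (unorderedPairs (allFin m)) ℕ.< ∣E∣ H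
  few-edges-per-pair = pairs-bound {K} {q} {p} {m} (m/n*n≤m (2 ℕ.* p ℕ.* m) q)
    (subst (λ n → 2 ℕ.* length (unorderedPairs (allFin m)) ℕ.+ n ≡ n ℕ.* n) (length-tabulate id)
           (length-unorderedPairs (allFin m)))
    (d*ℕtoℚ-≤ (m ^ 3) (∣E∣ H) dm³≤E)
    (ℕ.>-nonZero⁻¹ (p ℕ.* m ℕ.* m) {{ℕ.m*n≢0 (p ℕ.* m) m {{ℕ.m*n≢0 p m}}}})

  long-enough : ℕtoℚ 2 * (d * ℕtoℚ m + 1ℚ) ≤ ℕtoℚ (3 ℕ.+ K)
  long-enough = 2*[d*ℕtoℚ+1]-≤ m (3 ℕ.+ K) (path-length-bound {p} {m} {q} {K} 2pm<[1+K]q)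

  ten≤3+K : ℕtoℚ 10 < ℕtoℚ 2 * d * ℕtoℚ m → 10 ℕ.≤ 3 ℕ.+ K
  ten≤3+K 10<2dm = ℕ.≤-trans (ℕ.≤-pred (ℕ.*-cancelʳ-< q 10 (suc K) (ℕ.<-trans (<-2*d*ℕtoℚ m 10 10<2dm) 2pm<[1+K]q)))
                             (ℕ.m≤n+m K 3)
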